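{- Let $n\ge 1$ and let $(P_e)_{e\ge 0}$ be the Pell sequence, $P_0=0$, $P_1=1$, $P_{e+1}=2P_e+P_{e-1}$. Let $T_n=(a_{i,j})_{1\le i,j\le n}$ with $a_{i,j}=2^{i+j-n-1}\binom{i-1}{n-j}$, and let $v=((-1)^nP_{n-1},(-1)^{n-1}P_{n-2},\ldots,-P_0)^t$, i.e. $v_j=(-1)^{n+1-j}P_{n-j}$. Then: (1) for every integer $e\ge 0$, $T_n^{e+1}v=(P_{(n-1)e},P_{(n-1)e+1},\ldots,P_{(n-1)(e+1)})^t$; (2) writing $T_n^e=(a^{(e)}_{i,j})$, for every $e\ge1$ and all $2\le i,j\le n$, \[P_{e-1}a^{(e)}_{i,j}+P_e a^{(e)}_{i,j-1}=P_e a^{(e)}_{i-1,j}+P_{e+1}a^{(e)}_{i-1,j-1};\] (3) $T_n$ is the unique $n\times n$ matrix $(b_{i,j})$ such that $b_{1,j}=0$ for $1\le j<n$, $b_{i,n}=2^{i-1}$ for $1\le i\le n$, and $b_{i,j}=2b_{i-1,j}+b_{i-1,j+1}$ for $2\le i\le n$, $1\le j\le n-1$.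
   Context: Binomial coefficients $\binom{a}{b}$ are $0$ when $b<0$ or $b>a$; whenever $\binom{i-1}{n-j}\neq 0$ the exponent $i+j-n-1$ is nonnegative, so all entries of $T_n$ are integers. -}

module Defs where

open import Data.Nat as ℕ using (ℕ; zero; suc; _∸_)
open import Data.Nat.Combinatorics using (_C_)
open import Data.Integer as ℤ using (ℤ; +_; -_; _+_; _*_)
open import Data.Fin using (Fin; zero; suc; toℕ; _≟_)
open import Relation.Nullary using (yes; no)

Pell : ℕ → ℕ
Pell zero = zero
Pell (suc zero) = suc zero
Pell (suc (suc e)) = 2 ℕ.* Pell (suc e) ℕ.+ Pell e

P : ℕ → ℤ
P e = + Pell e

Mat : ℕ → Set
Mat n = Fin n → Fin n → ℤ

Vec' : ℕ → Set
Vec' n = Fin n → ℤ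

Σ : ∀ {n} → (Fin n → ℤ) → ℤ
Σ {zero} f = + 0
Σ {suc n} f = f zero + Σ (λ i → f (suc i))

_⊗_ : ∀ {n} → Mat n → Mat n → Mat n
(A ⊗ B) i j = Σ (λ k → A i k * B k j)

_·_ : ∀ {n} → Mat n → Vec' n → Vec' n
(A · v) i = Σ (λ k → A i k * v k)

I : ∀ {n} → Mat n
I i j with i ≟ j
... | yes _ = + 1
... | no _ = + 0

_^^_ : ∀ {n} → Mat n → ℕ → Mat n
A ^^ zero = I
A ^^ suc e = A ⊗ (A ^^ e)

sgn : ℕ → ℤ
sgn zero = + 1
sgn (suc k) = - sgn k

-- T_n with 0-based indices i' = i-1, j' = j-1:
-- a_{i,j} = 2^{i+j-n-1} * C(i-1, n-j) = 2^{(i'+j'+1) - n} * C(i', n-1-j').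
-- When i'+j'+1 < n we have n-1-j' > i', so the binomial is 0 and the
-- (truncated) exponent is irrelevant.
T : (n : ℕ) → Mat n
T n i j = + ((2 ℕ.^ ((toℕ i ℕ.+ toℕ j ℕ.+ 1) ∸ n)) ℕ.* (toℕ i C (n ∸ 1 ∸ toℕ j)))

-- v_j = (-1)^{n+1-j} P_{n-j}, i.e. with j' = j-1: (-1)^{n-j'} P_{n-1-j'}
v : (n : ℕ) → Vec' n
v n j = sgn (n ∸ toℕ j) * P (n ∸ 1 ∸ toℕ j)

{-# OPTIONS --safe #-}
-- With 0-based indices and n = m + 1, row a of T ^ (e + 1) holds the coefficients of y_e ^ a z_e ^ (m - a),
-- where y_e = P (e+1) + P (e+2) x and z_e = P e + P (e+1) x.  For e = 0 these are the rows (1 + 2x) ^ a x ^ (m - a),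
-- which satisfy the recursion of (3) because x (1 + 2x) ^ (a+1) x ^ (m-a-1) = (1 + 2x) (1 + 2x) ^ a x ^ (m-a), so they
-- form T by uniqueness.  Multiplying by T on the left substitutes y_e and z_e into the homogenised rows of T, and
-- z_e + 2 y_e = y_(e+1), y_e = z_(e+1) by the Pell recurrence, which is the induction step in e.  Part (2) is the identity
-- z_e · row (a+1) = y_e · row a.  For (1), v is the Pell sequence run backwards to negative indices, and pairing with
-- any sequence obeying the Pell recurrence turns multiplication by P c + P (c+1) x into a shift of the index by c + 1,
-- by the addition formula P c h t + P (c+1) h (t+1) = h (t+c+1).
module Submission where

open import Defs
import Data.Nat
open import Data.Nat as ℕ using (ℕ; zero; suc; _∸_; _<_; _≤_; s≤s)
import Data.Nat.Properties as ℕ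
open import Data.Nat.Combinatorics using (_C_; k>n⇒nCk≡0; nCk≡nC[n∸k]; nCn≡1; nCk+nC[k+1]≡[n+1]C[k+1])
import Data.Nat.Tactic.RingSolver as ℕ-Solver
open import Data.Integer as ℤ using (ℤ; +_; _+_; _*_; _-_; -_; _^_)
import Data.Integer.Properties as ℤ
open import Data.Integer.Tactic.RingSolver using (solve-∀)
open import Data.Fin using (Fin; zero; suc; toℕ; inject₁; fromℕ; _≟_)
import Data.Fin.Properties as Fin
open import Data.Fin.Relation.Unary.Top using (view; ‵fromℕ; ‵inject₁)
open import Data.Product using (_×_; _,_)
open import Data.Sum using (_⊎_; inj₁; inj₂)
open import Function using (_∘_)
open import Relation.Nullary using (yes; no)
open import Relation.Binary.PropositionalEquality

∸≡suc∸suc : ∀ {k n} → k < n → n ∸ k ≡ suc (n ∸ suc k)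
∸≡suc∸suc = ℕ.+-∸-assoc 1

m+[n∸m+0]≡n : ∀ {m n} → m ≤ n → m ℕ.+ (n ∸ m ℕ.+ 0) ≡ n
m+[n∸m+0]≡n {m} m≤n = trans (cong (m ℕ.+_) (ℕ.+-identityʳ _)) (ℕ.m+[n∸m]≡n m≤n)

pos-^ : ∀ n k → (+ n) ^ k ≡ + (n ℕ.^ k)
pos-^ n zero    = refl
pos-^ n (suc k) = trans (cong (+ n *_) (pos-^ n k)) (sym (ℤ.pos-* n (n ℕ.^ k)))

-- A polynomial is its coefficient sequence; mulLin a b p is the product (a + b x) p.
Poly : Set
Poly = ℕ → ℤ

mulLin : ℤ → ℤ → Poly → Poly
mulLin a b p zero    = a * p zero
mulLin a b p (suc t) = a * p (suc t) + b * p t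

mulLinPow : ℕ → ℤ → ℤ → Poly → Poly
mulLinPow zero    a b p = p
mulLinPow (suc k) a b p = mulLin a b (mulLinPow k a b p)

one : Poly
one zero    = + 1
one (suc t) = + 0

Degree≤ : ℕ → Poly → Set
Degree≤ d p = ∀ t → d < t → p t ≡ + 0

one-degree : Degree≤ 0 one
one-degree (suc t) _ = refl

mulLin-degree : ∀ {d p} a b → Degree≤ d p → Degree≤ (suc d) (mulLin a b p)
mulLin-degree a b deg (suc t) (s≤s d<t) =
  trans (cong₂ (λ x y → a * x + b * y) (deg (suc t) (ℕ.m<n⇒m<1+n d<t)) (deg t d<t))
        (cong₂ _+_ (ℤ.*-zeroʳ a) (ℤ.*-zeroʳ b))

mulLinPow-degree : ∀ k {d p} a b → Degree≤ d p → Degree≤ (k ℕ.+ d) (mulLinPow k a b p)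
mulLinPow-degree zero    a b deg = deg
mulLinPow-degree (suc k) a b deg = mulLin-degree a b (mulLinPow-degree k a b deg)

mulLinPow-top : ∀ k {d p} a b → Degree≤ d p → mulLinPow k a b p (k ℕ.+ d) ≡ b ^ k * p d
mulLinPow-top zero    {d} {p} a b deg = sym (ℤ.*-identityˡ (p d))
mulLinPow-top (suc k) {d} {p} a b deg = begin
  a * mulLinPow k a b p (suc (k ℕ.+ d)) + b * mulLinPow k a b p (k ℕ.+ d)
    ≡⟨ cong₂ (λ x y → a * x + b * y) (mulLinPow-degree k a b deg _ (ℕ.n<1+n _)) (mulLinPow-top k a b deg) ⟩
  a * + 0 + b * (b ^ k * p d)
    ≡⟨ cong (_+ b * (b ^ k * p d)) (ℤ.*-zeroʳ a) ⟩
  + 0 + b * (b ^ k * p d)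
    ≡⟨ ℤ.+-identityˡ _ ⟩
  b * (b ^ k * p d)
    ≡⟨ ℤ.*-assoc b (b ^ k) (p d) ⟨
  b * b ^ k * p d ∎
  where open ≡-Reasoning

mulLinPow-x-below : ∀ k p {t} → t < k → mulLinPow k (+ 0) (+ 1) p t ≡ + 0
mulLinPow-x-below (suc k) p {zero}  _         = refl
mulLinPow-x-below (suc k) p {suc t} (s≤s t<k) =
  cong (λ x → + 0 * mulLinPow k (+ 0) (+ 1) p (suc t) + + 1 * x) (mulLinPow-x-below k p t<k)

mulLin-cong : ∀ a b {p q} → p ≗ q → mulLin a b p ≗ mulLin a b q
mulLin-cong a b p≗q zero    = cong (a *_) (p≗q zero)
mulLin-cong a b p≗q (suc t) = cong₂ (λ x y → a * x + b * y) (p≗q (suc t)) (p≗q t)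

mulLin-comm : ∀ a b c d p → mulLin a b (mulLin c d p) ≗ mulLin c d (mulLin a b p)
mulLin-comm a b c d p zero          = comm₁ a c (p 0)
  where
  comm₁ : ∀ a c x → a * (c * x) ≡ c * (a * x)
  comm₁ = solve-∀
mulLin-comm a b c d p (suc zero)    = comm₂ a b c d (p 1) (p 0)
  where
  comm₂ : ∀ a b c d x y → a * (c * x + d * y) + b * (c * y) ≡ c * (a * x + b * y) + d * (a * y)
  comm₂ = solve-∀
mulLin-comm a b c d p (suc (suc t)) = comm₃ a b c d (p (suc (suc t))) (p (suc t)) (p t)
  where
  comm₃ : ∀ a b c d x y z → a * (c * x + d * y) + b * (c * y + d * z) ≡ c * (a * x + b * y) + d * (a * y + b * z)
  comm₃ = solve-∀

mulLinPow-comm : ∀ k a b c d p → mulLin c d (mulLinPow k a b p) ≗ mulLinPow k a b (mulLin c d p)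
mulLinPow-comm zero    a b c d p t = refl
mulLinPow-comm (suc k) a b c d p t =
  trans (mulLin-comm c d a b (mulLinPow k a b p) t) (mulLin-cong a b (mulLinPow-comm k a b c d p) t)

mulLin-combine : ∀ a b a₁ a₂ b₁ b₂ q t →
  a * mulLin b₁ b₂ q t + b * mulLin a₁ a₂ q t ≡ mulLin (a * b₁ + b * a₁) (a * b₂ + b * a₂) q t
mulLin-combine a b a₁ a₂ b₁ b₂ q zero    = combine₁ a b a₁ b₁ (q 0)
  where
  combine₁ : ∀ a b a₁ b₁ x → a * (b₁ * x) + b * (a₁ * x) ≡ (a * b₁ + b * a₁) * x
  combine₁ = solve-∀
mulLin-combine a b a₁ a₂ b₁ b₂ q (suc t) = combine₂ a b a₁ a₂ b₁ b₂ (q (suc t)) (q t)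
  where
  combine₂ : ∀ a b a₁ a₂ b₁ b₂ x y → a * (b₁ * x + b₂ * y) + b * (a₁ * x + a₂ * y)
                   ≡ (a * b₁ + b * a₁) * x + (a * b₂ + b * a₂) * y
  combine₂ = solve-∀

sumTo : ℕ → (ℕ → ℤ) → ℤ
sumTo zero    f = + 0
sumTo (suc n) f = f zero + sumTo n (f ∘ suc)

Σ-toℕ : ∀ n (f : ℕ → ℤ) → Σ {n} (f ∘ toℕ) ≡ sumTo n f
Σ-toℕ zero    f = refl
Σ-toℕ (suc n) f = cong (_+_ (f 0)) (Σ-toℕ n (f ∘ suc))

Σ-cong : ∀ n {f g : Fin n → ℤ} → (∀ k → f k ≡ g k) → Σ f ≡ Σ g
Σ-cong zero    f≗g = refl
Σ-cong (suc n) f≗g = cong₂ _+_ (f≗g zero) (Σ-cong n (f≗g ∘ suc))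

I-suc : ∀ {n} (k j : Fin n) → I (suc k) (suc j) ≡ I k j
I-suc k j with k ≟ j
... | yes _ = refl
... | no  _ = refl

Σ-*-zeroʳ : ∀ n (f : Fin n → ℤ) → Σ (λ k → f k * + 0) ≡ + 0
Σ-*-zeroʳ zero    f = refl
Σ-*-zeroʳ (suc n) f = cong₂ _+_ (ℤ.*-zeroʳ (f zero)) (Σ-*-zeroʳ n (f ∘ suc))

Σ-*-I : ∀ n (f : Fin n → ℤ) j → Σ (λ k → f k * I k j) ≡ f j
Σ-*-I (suc n) f zero    =
  trans (cong₂ _+_ (ℤ.*-identityʳ (f zero)) (Σ-*-zeroʳ n (f ∘ suc))) (ℤ.+-identityʳ (f zero))
Σ-*-I (suc n) f (suc j) =
  trans (cong₂ _+_ (ℤ.*-zeroʳ (f zero))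
                   (trans (Σ-cong n (λ k → cong (f (suc k) *_) (I-suc k j))) (Σ-*-I n (f ∘ suc) j)))
        (ℤ.+-identityˡ (f (suc j)))

sumTo-cong : ∀ n {f g : ℕ → ℤ} → (∀ k → k < n → f k ≡ g k) → sumTo n f ≡ sumTo n g
sumTo-cong zero    f≗g = refl
sumTo-cong (suc n) f≗g = cong₂ _+_ (f≗g 0 (s≤s ℕ.z≤n)) (sumTo-cong n (λ k k<n → f≗g (suc k) (s≤s k<n)))

sumTo-suc : ∀ n f → sumTo (suc n) f ≡ sumTo n f + f n
sumTo-suc zero    f = trans (ℤ.+-identityʳ (f 0)) (sym (ℤ.+-identityˡ (f 0)))
sumTo-suc (suc n) f = trans (cong (_+_ (f 0)) (sumTo-suc n (f ∘ suc))) (sym (ℤ.+-assoc (f 0) _ _))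

sumTo-scale : ∀ n a f → sumTo n (λ k → a * f k) ≡ a * sumTo n f
sumTo-scale zero    a f = sym (ℤ.*-zeroʳ a)
sumTo-scale (suc n) a f =
  trans (cong (_+_ (a * f 0)) (sumTo-scale n a (f ∘ suc))) (sym (ℤ.*-distribˡ-+ a _ _))

sumTo-linear : ∀ n a b f g → sumTo n (λ k → a * f k + b * g k) ≡ a * sumTo n f + b * sumTo n g
sumTo-linear zero    a b f g = sym (cong₂ _+_ (ℤ.*-zeroʳ a) (ℤ.*-zeroʳ b))
sumTo-linear (suc n) a b f g =
  trans (cong (_+_ (a * f 0 + b * g 0)) (sumTo-linear n a b (f ∘ suc) (g ∘ suc)))
        (regroup a b (f 0) (g 0) (sumTo n (f ∘ suc)) (sumTo n (g ∘ suc)))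
  where
  regroup : ∀ a b x y u w → a * x + b * y + (a * u + b * w) ≡ a * (x + u) + b * (y + w)
  regroup = solve-∀

dot : ℕ → Poly → (ℕ → ℤ) → ℤ
dot n p h = sumTo n (λ k → p k * h k)

dot-cong : ∀ n p {h h′ : ℕ → ℤ} → (∀ k → k < n → h k ≡ h′ k) → dot n p h ≡ dot n p h′
dot-cong n p h≗h′ = sumTo-cong n (λ k k<n → cong (p k *_) (h≗h′ k k<n))

dot-scale : ∀ n p a h → dot n p (λ k → a * h k) ≡ a * dot n p h
dot-scale n p a h = trans (sumTo-cong n (λ k _ → swap a (p k) (h k))) (sumTo-scale n a _)
  where
  swap : ∀ a x y → x * (a * y) ≡ a * (x * y)
  swap = solve-∀

dot-linear : ∀ n p a b h h′ → dot n p (λ k → a * h k + b * h′ k) ≡ a * dot n p h + b * dot n p h′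
dot-linear n p a b h h′ =
  trans (sumTo-cong n (λ k _ → distrib a b (p k) (h k) (h′ k))) (sumTo-linear n a b _ _)
  where
  distrib : ∀ a b x y z → x * (a * y + b * z) ≡ a * (x * y) + b * (x * z)
  distrib = solve-∀

dot-one : ∀ h → dot 1 one h ≡ h 0
dot-one h = trans (ℤ.+-identityʳ _) (ℤ.*-identityˡ (h 0))

dot-mulLin : ∀ n a b p h → dot (suc n) (mulLin a b p) h ≡ a * dot (suc n) p h + b * dot n p (h ∘ suc)
dot-mulLin n a b p h = begin
  a * p 0 * h 0 + sumTo n (λ t → (a * p (suc t) + b * p t) * h (suc t))
    ≡⟨ cong (_+_ (a * p 0 * h 0)) (trans (sumTo-cong n (λ t _ → distrib a b (p (suc t)) (p t) (h (suc t))))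
                                      (sumTo-linear n a b _ _)) ⟩
  a * p 0 * h 0 + (a * S₁ + b * S₂)
    ≡⟨ regroup a b (p 0) (h 0) S₁ S₂ ⟩
  a * (p 0 * h 0 + S₁) + b * S₂ ∎
  where
  open ≡-Reasoning
  S₁ = sumTo n (λ t → p (suc t) * h (suc t))
  S₂ = dot n p (h ∘ suc)
  distrib : ∀ a b x y z → (a * x + b * y) * z ≡ a * (x * z) + b * (y * z)
  distrib = solve-∀
  regroup : ∀ a b x y u w → a * x * y + (a * u + b * w) ≡ a * (x * y + u) + b * w
  regroup = solve-∀

dot-beyond-degree : ∀ n {p} h → Degree≤ n p → dot (suc (suc n)) p h ≡ dot (suc n) p h
dot-beyond-degree n {p} h deg = begin
  dot (suc (suc n)) p h
    ≡⟨ sumTo-suc (suc n) (λ k → p k * h k) ⟩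
  dot (suc n) p h + p (suc n) * h (suc n)
    ≡⟨ cong (λ x → dot (suc n) p h + x * h (suc n)) (deg (suc n) (ℕ.n<1+n n)) ⟩
  dot (suc n) p h + + 0
    ≡⟨ ℤ.+-identityʳ _ ⟩
  dot (suc n) p h ∎
  where open ≡-Reasoning

dot-mulLin-degree : ∀ n a b {p} h → Degree≤ n p →
  dot (suc (suc n)) (mulLin a b p) h ≡ a * dot (suc n) p h + b * dot (suc n) p (h ∘ suc)
dot-mulLin-degree n a b {p} h deg =
  trans (dot-mulLin (suc n) a b p h) (cong (λ x → a * x + b * dot (suc n) p (h ∘ suc)) (dot-beyond-degree n h deg))

dot-mulLin-family : ∀ n c a b (f : ℕ → Poly) t →
  dot n c (λ k → mulLin a b (f k) t) ≡ mulLin a b (λ s → dot n c (λ k → f k s)) t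
dot-mulLin-family n c a b f zero    = dot-scale n c a _
dot-mulLin-family n c a b f (suc t) = dot-linear n c a b _ _

-- For y = a₁ + a₂ x and z = b₁ + b₂ x, homSubst n p is z ^ n · p (y / z) when p has degree ≤ n.
module HomogeneousSubstitution (a₁ a₂ b₁ b₂ : ℤ) where

  basis : ℕ → ℕ → Poly
  basis n k = mulLinPow k a₁ a₂ (mulLinPow (n ∸ k) b₁ b₂ one)

  homSubst : ℕ → Poly → Poly
  homSubst n p t = dot (suc n) p (λ k → basis n k t)

  basis-suc : ∀ {n k} → k ≤ n → basis (suc n) k ≗ mulLin b₁ b₂ (basis n k)
  basis-suc {n} {k} k≤n t rewrite ℕ.+-∸-assoc 1 k≤n = sym (mulLinPow-comm k a₁ a₂ b₁ b₂ _ t)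

  basis-adjacent : ∀ {n k} → k < n → mulLin b₁ b₂ (basis n (suc k)) ≗ mulLin a₁ a₂ (basis n k)
  basis-adjacent {n} {k} k<n t rewrite ∸≡suc∸suc k<n = mulLinPow-comm (suc k) a₁ a₂ b₁ b₂ _ t

  homSubst-one : homSubst 0 one ≗ one
  homSubst-one t = dot-one (λ k → basis 0 k t)

  homSubst-mulLin : ∀ {n p c d} a b → a * b₁ + b * a₁ ≡ c → a * b₂ + b * a₂ ≡ d → Degree≤ n p →
                    homSubst (suc n) (mulLin a b p) ≗ mulLin c d (homSubst n p)
  homSubst-mulLin {n} {p} a b refl refl deg t = begin
    dot (suc (suc n)) (mulLin a b p) (λ k → basis (suc n) k t)
      ≡⟨ dot-mulLin-degree n a b (λ k → basis (suc n) k t) deg ⟩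
    a * dot (suc n) p (λ k → basis (suc n) k t) + b * dot (suc n) p (λ k → mulLin a₁ a₂ (basis n k) t)
      ≡⟨ cong (λ x → a * x + b * dot (suc n) p (λ k → mulLin a₁ a₂ (basis n k) t))
              (dot-cong (suc n) p (λ k k<1+n → basis-suc (ℕ.≤-pred k<1+n) t)) ⟩
    a * dot (suc n) p (λ k → mulLin b₁ b₂ (basis n k) t) + b * dot (suc n) p (λ k → mulLin a₁ a₂ (basis n k) t)
      ≡⟨ cong₂ (λ x y → a * x + b * y) (dot-mulLin-family (suc n) p b₁ b₂ (basis n) t)
                                       (dot-mulLin-family (suc n) p a₁ a₂ (basis n) t) ⟩
    a * mulLin b₁ b₂ (homSubst n p) t + b * mulLin a₁ a₂ (homSubst n p) t
      ≡⟨ mulLin-combine a b a₁ a₂ b₁ b₂ (homSubst n p) t ⟩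
    mulLin (a * b₁ + b * a₁) (a * b₂ + b * a₂) (homSubst n p) t ∎
    where open ≡-Reasoning

  homSubst-mulLinPow : ∀ k {n p q c d} a b → a * b₁ + b * a₁ ≡ c → a * b₂ + b * a₂ ≡ d →
                       Degree≤ n p → homSubst n p ≗ q → homSubst (k ℕ.+ n) (mulLinPow k a b p) ≗ mulLinPow k c d q
  homSubst-mulLinPow zero    a b _   _   _   p↦q = p↦q
  homSubst-mulLinPow (suc k) {c = c} {d} a b c≡ d≡ deg p↦q t =
    trans (homSubst-mulLin a b c≡ d≡ (mulLinPow-degree k a b deg) t)
          (mulLin-cong c d (homSubst-mulLinPow k a b c≡ d≡ deg p↦q) t)

P-rec : ∀ e → P (suc (suc e)) ≡ + 2 * P (suc e) + P e
P-rec e = trans (ℤ.pos-+ (2 ℕ.* Pell (suc e)) (Pell e)) (cong (_+ P e) (ℤ.pos-* 2 (Pell (suc e))))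

PellLike : (ℕ → ℤ) → Set
PellLike h = ∀ t → h (suc (suc t)) ≡ + 2 * h (suc t) + h t

PellLike-add : ∀ h → PellLike h → ∀ c t → P c * h t + P (suc c) * h (suc t) ≡ h (t ℕ.+ suc c)
PellLike-add h pell zero    t = trans (ℤ.+-identityˡ (+ 1 * h (suc t)))
                                        (trans (ℤ.*-identityˡ (h (suc t))) (cong h (ℕ.+-comm 1 t)))
PellLike-add h pell (suc c) t = begin
  P (suc c) * h t + P (suc (suc c)) * h (suc t)
    ≡⟨ cong (λ x → P (suc c) * h t + x * h (suc t)) (P-rec c) ⟩
  P (suc c) * h t + (+ 2 * P (suc c) + P c) * h (suc t)
    ≡⟨ regroup (P (suc c)) (P c) (h t) (h (suc t)) ⟩
  P c * h (suc t) + P (suc c) * (+ 2 * h (suc t) + h t)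
    ≡⟨ cong (λ x → P c * h (suc t) + P (suc c) * x) (pell t) ⟨
  P c * h (suc t) + P (suc c) * h (suc (suc t))
    ≡⟨ PellLike-add h pell c (suc t) ⟩
  h (suc t ℕ.+ suc c)
    ≡⟨ cong h (ℕ.+-suc t (suc c)) ⟨
  h (t ℕ.+ suc (suc c)) ∎
  where
  open ≡-Reasoning
  regroup : ∀ p₁ p₀ x y → p₁ * x + (+ 2 * p₁ + p₀) * y ≡ p₀ * y + p₁ * (+ 2 * y + x)
  regroup = solve-∀

dot-mulLinPow-pell : ∀ k {n p} h c → PellLike h → Degree≤ n p →
  dot (suc (k ℕ.+ n)) (mulLinPow k (P c) (P (suc c)) p) h ≡ dot (suc n) p (λ t → h (t ℕ.+ k ℕ.* suc c))
dot-mulLinPow-pell zero {n} {p} h c pell deg = dot-cong (suc n) p (λ t _ → cong h (sym (ℕ.+-identityʳ t)))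
dot-mulLinPow-pell (suc k) {n} {p} h c pell deg = begin
  dot (suc (suc (k ℕ.+ n))) (mulLin (P c) (P (suc c)) q) h
    ≡⟨ dot-mulLin-degree (k ℕ.+ n) (P c) (P (suc c)) h (mulLinPow-degree k (P c) (P (suc c)) deg) ⟩
  P c * dot (suc (k ℕ.+ n)) q h + P (suc c) * dot (suc (k ℕ.+ n)) q (h ∘ suc)
    ≡⟨ dot-linear (suc (k ℕ.+ n)) q (P c) (P (suc c)) h (h ∘ suc) ⟨
  dot (suc (k ℕ.+ n)) q (λ t → P c * h t + P (suc c) * h (suc t))
    ≡⟨ dot-cong (suc (k ℕ.+ n)) q (λ t _ → PellLike-add h pell c t) ⟩
  dot (suc (k ℕ.+ n)) q (λ t → h (t ℕ.+ suc c))
    ≡⟨ dot-mulLinPow-pell k (λ t → h (t ℕ.+ suc c)) c (λ t → pell (t ℕ.+ suc c)) deg ⟩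
  dot (suc n) p (λ t → h (t ℕ.+ k ℕ.* suc c ℕ.+ suc c))
    ≡⟨ dot-cong (suc n) p (λ t _ → cong h (shift t)) ⟩
  dot (suc n) p (λ t → h (t ℕ.+ suc k ℕ.* suc c)) ∎
  where
  open ≡-Reasoning
  q = mulLinPow k (P c) (P (suc c)) p
  shift : ∀ t → t ℕ.+ k ℕ.* suc c ℕ.+ suc c ≡ t ℕ.+ (suc c ℕ.+ k ℕ.* suc c)
  shift t = trans (ℕ.+-assoc t _ (suc c)) (cong (t ℕ.+_) (ℕ.+-comm (k ℕ.* suc c) (suc c)))

-- pellRows e n a is (P (e+1) + P (e+2) x) ^ a (P e + P (e+1) x) ^ (n ∸ a).
pellRows : ℕ → ℕ → ℕ → Poly
pellRows e = HomogeneousSubstitution.basis (P (suc e)) (P (suc (suc e))) (P e) (P (suc e))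

pellRows-adjacent : ∀ e {n a} b → a < n →
  P e * pellRows e n (suc a) (suc b) + P (suc e) * pellRows e n (suc a) b
    ≡ P (suc e) * pellRows e n a (suc b) + P (suc (suc e)) * pellRows e n a b
pellRows-adjacent e b a<n =
  HomogeneousSubstitution.basis-adjacent (P (suc e)) (P (suc (suc e))) (P e) (P (suc e)) a<n (suc b)

module _ (e : ℕ) where
  open HomogeneousSubstitution (P (suc e)) (P (suc (suc e))) (P e) (P (suc e))

  homSubst-pellRows : ∀ {n a} → a ≤ n → homSubst n (pellRows 0 n a) ≗ pellRows (suc e) n a
  homSubst-pellRows {n} {a} a≤n =
    subst (λ m → homSubst m (pellRows 0 n a) ≗ pellRows (suc e) n a) (m+[n∸m+0]≡n a≤n)
      (homSubst-mulLinPow a (+ 1) (+ 2) (pell-step e) (pell-step (suc e))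
        (mulLinPow-degree (n ∸ a) (+ 0) (+ 1) one-degree)
        (homSubst-mulLinPow (n ∸ a) (+ 0) (+ 1) (x-step (P e) (P (suc e))) (x-step (P (suc e)) (P (suc (suc e))))
          one-degree homSubst-one))
    where
    pell-step : ∀ c → + 1 * P c + + 2 * P (suc c) ≡ P (suc (suc c))
    pell-step c = trans (trans (cong (_+ + 2 * P (suc c)) (ℤ.*-identityˡ (P c))) (ℤ.+-comm (P c) (+ 2 * P (suc c))))
                        (sym (P-rec c))
    x-step : ∀ x y → + 0 * x + + 1 * y ≡ y
    x-step = solve-∀

dot-pellRows : ∀ e {n a} h → PellLike h → a ≤ n →
  dot (suc n) (pellRows e n a) h ≡ h ((n ∸ a) ℕ.* suc e ℕ.+ a ℕ.* suc (suc e))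
dot-pellRows e {n} {a} h pell a≤n = begin
  dot (suc n) (pellRows e n a) h
    ≡⟨ cong (λ m → dot (suc m) (pellRows e n a) h) (m+[n∸m+0]≡n a≤n) ⟨
  dot (suc (a ℕ.+ (d ℕ.+ 0))) (pellRows e n a) h
    ≡⟨ dot-mulLinPow-pell a h (suc e) pell (mulLinPow-degree d (P e) (P (suc e)) one-degree) ⟩
  dot (suc (d ℕ.+ 0)) (mulLinPow d (P e) (P (suc e)) one) (λ t → h (t ℕ.+ a ℕ.* suc (suc e)))
    ≡⟨ dot-mulLinPow-pell d (λ t → h (t ℕ.+ a ℕ.* suc (suc e))) e
                          (λ t → pell (t ℕ.+ a ℕ.* suc (suc e))) one-degree ⟩
  dot 1 one (λ t → h (t ℕ.+ d ℕ.* suc e ℕ.+ a ℕ.* suc (suc e)))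
    ≡⟨ dot-one (λ t → h (t ℕ.+ d ℕ.* suc e ℕ.+ a ℕ.* suc (suc e))) ⟩
  h (d ℕ.* suc e ℕ.+ a ℕ.* suc (suc e)) ∎
  where
  open ≡-Reasoning
  d = n ∸ a

-- pellFrom m t = P (t - m), where P is extended to negative indices by running the recurrence backwards.
pellFrom : ℕ → ℕ → ℤ
pellFrom zero    t       = P t
pellFrom (suc m) zero    = pellFrom m 1 - + 2 * pellFrom m 0
pellFrom (suc m) (suc t) = pellFrom m t

pellFrom-PellLike : ∀ m → PellLike (pellFrom m)
pellFrom-PellLike zero    t       = P-rec t
pellFrom-PellLike (suc m) zero    = backwards (pellFrom m 1) (pellFrom m 0)
  where
  backwards : ∀ x y → x ≡ + 2 * y + (x - + 2 * y)
  backwards = solve-∀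
pellFrom-PellLike (suc m) (suc t) = pellFrom-PellLike m t

pellFrom-shift : ∀ m t → pellFrom m (m ℕ.+ t) ≡ P t
pellFrom-shift zero    t = refl
pellFrom-shift (suc m) t = pellFrom-shift m t

pellFrom-diagonal : ∀ d t → pellFrom (t ℕ.+ d) t ≡ pellFrom d 0
pellFrom-diagonal d zero    = refl
pellFrom-diagonal d (suc t) = pellFrom-diagonal d t

pellFrom-negative : ∀ d → pellFrom d 0 ≡ sgn (suc d) * P d
pellFrom-negative zero          = refl
pellFrom-negative (suc zero)    = refl
pellFrom-negative (suc (suc d)) = begin
  pellFrom d 0 - + 2 * pellFrom (suc d) 0
    ≡⟨ cong₂ (λ x y → x - + 2 * y) (pellFrom-negative d) (pellFrom-negative (suc d)) ⟩
  - sgn d * P d - + 2 * (- - sgn d * P (suc d))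
    ≡⟨ flip-sign (sgn d) (P d) (P (suc d)) ⟩
  - - - sgn d * (+ 2 * P (suc d) + P d)
    ≡⟨ cong (- - - sgn d *_) (P-rec d) ⟨
  - - - sgn d * P (suc (suc d)) ∎
  where
  open ≡-Reasoning
  flip-sign : ∀ s x y → - s * x - + 2 * (- - s * y) ≡ - - - s * (+ 2 * y + x)
  flip-sign = solve-∀

v≡pellFrom : ∀ m (k : Fin (suc m)) → v (suc m) k ≡ pellFrom m (toℕ k)
v≡pellFrom m k = begin
  sgn (suc m ∸ t) * P (m ∸ t)     ≡⟨ cong (λ z → sgn z * P (m ∸ t)) (ℕ.+-∸-assoc 1 t≤m) ⟩
  sgn (suc (m ∸ t)) * P (m ∸ t)   ≡⟨ pellFrom-negative (m ∸ t) ⟨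
  pellFrom (m ∸ t) 0              ≡⟨ pellFrom-diagonal (m ∸ t) t ⟨
  pellFrom (t ℕ.+ (m ∸ t)) t      ≡⟨ cong (λ z → pellFrom z t) (ℕ.m+[n∸m]≡n t≤m) ⟩
  pellFrom m t ∎
  where
  open ≡-Reasoning
  t = toℕ k
  t≤m = Fin.toℕ≤pred[n] k

TConditions : ∀ m → Mat (suc m) → Set
TConditions m B =
    ((j : Fin m) → B zero (inject₁ j) ≡ + 0)
  × ((i : Fin (suc m)) → B i (fromℕ m) ≡ + (2 ℕ.^ toℕ i))
  × ((i j : Fin m) → B (suc i) (inject₁ j) ≡ + 2 * B (inject₁ i) (inject₁ j) + B (inject₁ i) (suc j))

TConditions-unique : ∀ {m A B} → TConditions m A → TConditions m B → ∀ i j → A i j ≡ B i j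
TConditions-unique {m} {A} {B} (A-top , A-last , A-rec) (B-top , B-last , B-rec) i = row (toℕ i) i refl
  where
  row : ∀ r (i : Fin (suc m)) → toℕ i ≡ r → ∀ j → A i j ≡ B i j
  column : ∀ r (i : Fin (suc m)) → toℕ i ≡ r → ∀ j → A i (inject₁ j) ≡ B i (inject₁ j)
  row r i i≡r j with view j
  ... | ‵fromℕ     = trans (A-last i) (sym (B-last i))
  ... | ‵inject₁ j = column r i i≡r j
  column zero    zero    _   j = trans (A-top j) (sym (B-top j))
  column zero    (suc i) ()
  column (suc r) zero    ()
  column (suc r) (suc i) i≡r j = begin
    A (suc i) (inject₁ j)                                ≡⟨ A-rec i j ⟩
    + 2 * A (inject₁ i) (inject₁ j) + A (inject₁ i) (suc j)
      ≡⟨ cong₂ (λ x y → + 2 * x + y) (row r (inject₁ i) above (inject₁ j)) (row r (inject₁ i) above (suc j)) ⟩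
    + 2 * B (inject₁ i) (inject₁ j) + B (inject₁ i) (suc j) ≡⟨ B-rec i j ⟨
    B (suc i) (inject₁ j) ∎
    where
    open ≡-Reasoning
    above = trans (Fin.toℕ-inject₁ i) (ℕ.suc-injective i≡r)

TConditions-tabulate : ∀ m (f : ℕ → ℕ → ℤ) →
  (∀ {b} → b < m → f 0 b ≡ + 0) →
  (∀ {a} → a ≤ m → f a m ≡ + (2 ℕ.^ a)) →
  (∀ {a b} → a < m → b < m → f (suc a) b ≡ + 2 * f a b + f a (suc b)) →
  TConditions m (λ i j → f (toℕ i) (toℕ j))
TConditions-tabulate m f top last rec = top′ , last′ , rec′
  where
  top′ : ∀ j → f 0 (toℕ (inject₁ j)) ≡ + 0
  top′ j = top (Fin.inject₁ℕ< j)
  last′ : ∀ i → f (toℕ i) (toℕ (fromℕ m)) ≡ + (2 ℕ.^ toℕ i)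
  last′ i = trans (cong (f (toℕ i)) (Fin.toℕ-fromℕ m)) (last (Fin.toℕ≤pred[n] i))
  rec′ : ∀ i j → f (suc (toℕ i)) (toℕ (inject₁ j))
               ≡ + 2 * f (toℕ (inject₁ i)) (toℕ (inject₁ j)) + f (toℕ (inject₁ i)) (suc (toℕ j))
  rec′ i j rewrite Fin.toℕ-inject₁ i | Fin.toℕ-inject₁ j = rec (Fin.toℕ<n i) (Fin.toℕ<n j)

tEntry : ℕ → ℕ → ℕ → ℕ
tEntry m a b = 2 ℕ.^ ((a ℕ.+ b ℕ.+ 1) ∸ suc m) ℕ.* (a C (m ∸ b))

tEntry-top : ∀ {m b} → b < m → tEntry m 0 b ≡ 0
tEntry-top {m} {b} b<m =
  trans (cong (2 ℕ.^ ((b ℕ.+ 1) ∸ suc m) ℕ.*_) (k>n⇒nCk≡0 (ℕ.m<n⇒0<n∸m b<m)))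
        (ℕ.*-zeroʳ (2 ℕ.^ ((b ℕ.+ 1) ∸ suc m)))

tEntry-last : ∀ m a → tEntry m a m ≡ 2 ℕ.^ a
tEntry-last m a = begin
  2 ℕ.^ ((a ℕ.+ m ℕ.+ 1) ∸ suc m) ℕ.* (a C (m ∸ m))
    ≡⟨ cong₂ (λ x y → 2 ℕ.^ x ℕ.* (a C y)) exponent (ℕ.n∸n≡0 m) ⟩
  2 ℕ.^ a ℕ.* (a C 0)
    ≡⟨ cong (2 ℕ.^ a ℕ.*_) (trans (nCk≡nC[n∸k] {0} {a} ℕ.z≤n) (nCn≡1 a)) ⟩
  2 ℕ.^ a ℕ.* 1
    ≡⟨ ℕ.*-identityʳ _ ⟩
  2 ℕ.^ a ∎
  where
  open ≡-Reasoning
  exponent : (a ℕ.+ m ℕ.+ 1) ∸ suc m ≡ a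
  exponent = trans (cong (_∸ suc m) (ℕ.+-comm (a ℕ.+ m) 1)) (ℕ.m+n∸n≡m a m)

-- The truncation of x ∸ m matters only where the binomial factor c vanishes.
2^∸-double : ∀ x m c → c ≡ 0 ⊎ m < x → 2 ℕ.^ (x ∸ m) ℕ.* c ≡ 2 ℕ.* (2 ℕ.^ (x ∸ suc m) ℕ.* c)
2^∸-double x m c (inj₁ refl) =
  trans (ℕ.*-zeroʳ (2 ℕ.^ (x ∸ m))) (cong (2 ℕ.*_) (sym (ℕ.*-zeroʳ (2 ℕ.^ (x ∸ suc m)))))
2^∸-double x m c (inj₂ m<x)  =
  trans (cong (λ y → 2 ℕ.^ y ℕ.* c) (∸≡suc∸suc m<x)) (ℕ.*-assoc 2 (2 ℕ.^ (x ∸ suc m)) c)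

C∸≡0⊎< : ∀ a b m → a C (m ∸ b) ≡ 0 ⊎ m < a ℕ.+ b ℕ.+ 1
C∸≡0⊎< a b m with m ∸ b ℕ.≤? a
... | no  m∸b≰a = inj₁ (k>n⇒nCk≡0 (ℕ.≰⇒> m∸b≰a))
... | yes m∸b≤a = inj₂ (ℕ.≤-<-trans m≤a+b (ℕ.m<m+n (a ℕ.+ b) (s≤s ℕ.z≤n)))
  where
  m≤a+b : m ≤ a ℕ.+ b
  m≤a+b = ℕ.≤-trans (ℕ.m≤n+m∸n m b) (ℕ.≤-trans (ℕ.+-monoʳ-≤ b m∸b≤a) (ℕ.≤-reflexive (ℕ.+-comm b a)))

tEntry-rec : ∀ {m} a {b} → b < m → tEntry m (suc a) b ≡ 2 ℕ.* tEntry m a b ℕ.+ tEntry m a (suc b)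
tEntry-rec {m} a {b} b<m = begin
  2 ℕ.^ (x ∸ m) ℕ.* (suc a C (m ∸ b))
    ≡⟨ cong (2 ℕ.^ (x ∸ m) ℕ.*_) pascal ⟩
  2 ℕ.^ (x ∸ m) ℕ.* (a C (m ∸ b) ℕ.+ a C (m ∸ suc b))
    ≡⟨ ℕ.*-distribˡ-+ (2 ℕ.^ (x ∸ m)) _ _ ⟩
  2 ℕ.^ (x ∸ m) ℕ.* (a C (m ∸ b)) ℕ.+ 2 ℕ.^ (x ∸ m) ℕ.* (a C (m ∸ suc b))
    ≡⟨ cong₂ ℕ._+_ (2^∸-double x m _ (C∸≡0⊎< a b m))
                   (cong (λ y → 2 ℕ.^ ((y ℕ.+ 1) ∸ suc m) ℕ.* (a C (m ∸ suc b))) (sym (ℕ.+-suc a b))) ⟩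
  2 ℕ.* tEntry m a b ℕ.+ tEntry m a (suc b) ∎
  where
  open ≡-Reasoning
  x = a ℕ.+ b ℕ.+ 1
  pascal : suc a C (m ∸ b) ≡ a C (m ∸ b) ℕ.+ a C (m ∸ suc b)
  pascal rewrite ∸≡suc∸suc b<m =
    trans (sym (nCk+nC[k+1]≡[n+1]C[k+1] a (m ∸ suc b))) (ℕ.+-comm (a C (m ∸ suc b)) _)

T-conditions : ∀ m → TConditions m (T (suc m))
T-conditions m = TConditions-tabulate m (λ a b → + tEntry m a b)
  (λ b<m → cong +_ (tEntry-top b<m))
  (λ {a} _ → cong +_ (tEntry-last m a))
  (λ {a} {b} _ b<m → trans (cong +_ (tEntry-rec a b<m))
                           (trans (ℤ.pos-+ (2 ℕ.* tEntry m a b) (tEntry m a (suc b)))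
                                  (cong (_+ + tEntry m a (suc b)) (ℤ.pos-* 2 (tEntry m a b)))))

pellRows₀-conditions : ∀ m → TConditions m (λ i j → pellRows 0 m (toℕ i) (toℕ j))
pellRows₀-conditions m = TConditions-tabulate m (pellRows 0 m)
  (λ b<m → mulLinPow-x-below m one b<m)
  last
  (λ {a} {b} a<m _ → trans (sym (drop (pellRows 0 m (suc a) (suc b)) (pellRows 0 m (suc a) b)))
                           (trans (pellRows-adjacent 0 b a<m) (swap (pellRows 0 m a (suc b)) (pellRows 0 m a b))))
  where
  drop : ∀ x y → + 0 * x + + 1 * y ≡ y
  drop = solve-∀
  swap : ∀ x y → + 1 * x + + 2 * y ≡ + 2 * y + x
  swap = solve-∀
  last : ∀ {a} → a ≤ m → pellRows 0 m a m ≡ + (2 ℕ.^ a)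
  last {a} a≤m = begin
    pellRows 0 m a m
      ≡⟨ cong (pellRows 0 m a) (m+[n∸m+0]≡n a≤m) ⟨
    mulLinPow a (+ 1) (+ 2) q (a ℕ.+ (d ℕ.+ 0))
      ≡⟨ mulLinPow-top a (+ 1) (+ 2) (mulLinPow-degree d (+ 0) (+ 1) one-degree) ⟩
    (+ 2) ^ a * q (d ℕ.+ 0)
      ≡⟨ cong ((+ 2) ^ a *_) (mulLinPow-top d (+ 0) (+ 1) one-degree) ⟩
    (+ 2) ^ a * ((+ 1) ^ d * + 1)
      ≡⟨ cong₂ (λ x y → x * (y * + 1)) (pos-^ 2 a) (ℤ.^-zeroˡ d) ⟩
    + (2 ℕ.^ a) * + 1
      ≡⟨ ℤ.*-identityʳ _ ⟩
    + (2 ℕ.^ a) ∎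
    where
    open ≡-Reasoning
    d = m ∸ a
    q = mulLinPow d (+ 0) (+ 1) one

T≡pellRows₀ : ∀ m (i j : Fin (suc m)) → T (suc m) i j ≡ pellRows 0 m (toℕ i) (toℕ j)
T≡pellRows₀ m = TConditions-unique (T-conditions m) (pellRows₀-conditions m)

T^-entry : ∀ m e (i j : Fin (suc m)) → (T (suc m) ^^ suc e) i j ≡ pellRows e m (toℕ i) (toℕ j)
T^-entry m zero    i j = trans (Σ-*-I (suc m) (T (suc m) i) j) (T≡pellRows₀ m i j)
T^-entry m (suc e) i j = begin
  Σ (λ k → T (suc m) i k * (T (suc m) ^^ suc e) k j)
    ≡⟨ Σ-cong (suc m) (λ k → cong₂ _*_ (T≡pellRows₀ m i k) (T^-entry m e k j)) ⟩
  Σ {suc m} (λ k → pellRows 0 m (toℕ i) (toℕ k) * pellRows e m (toℕ k) (toℕ j))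
    ≡⟨ Σ-toℕ (suc m) (λ k → pellRows 0 m (toℕ i) k * pellRows e m k (toℕ j)) ⟩
  dot (suc m) (pellRows 0 m (toℕ i)) (λ k → pellRows e m k (toℕ j))
    ≡⟨ homSubst-pellRows e (Fin.toℕ≤pred[n] i) (toℕ j) ⟩
  pellRows (suc e) m (toℕ i) (toℕ j) ∎
  where open ≡-Reasoning

T^-adjacent : ∀ m e (i j : Fin m) →
  P e * (T (suc m) ^^ suc e) (suc i) (suc j) + P (suc e) * (T (suc m) ^^ suc e) (suc i) (inject₁ j)
    ≡ P (suc e) * (T (suc m) ^^ suc e) (inject₁ i) (suc j) + P (suc (suc e)) * (T (suc m) ^^ suc e) (inject₁ i) (inject₁ j)
T^-adjacent m e i j
  rewrite T^-entry m e (suc i) (suc j) | T^-entry m e (suc i) (inject₁ j)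
        | T^-entry m e (inject₁ i) (suc j) | T^-entry m e (inject₁ i) (inject₁ j)
        | Fin.toℕ-inject₁ i | Fin.toℕ-inject₁ j
  = pellRows-adjacent e (toℕ j) (Fin.toℕ<n i)

T^·v : ∀ m e (j : Fin (suc m)) → ((T (suc m) ^^ suc e) · v (suc m)) j ≡ P (m ℕ.* e ℕ.+ toℕ j)
T^·v m e j = begin
  Σ (λ k → (T (suc m) ^^ suc e) j k * v (suc m) k)
    ≡⟨ Σ-cong (suc m) (λ k → cong₂ _*_ (T^-entry m e j k) (v≡pellFrom m k)) ⟩
  Σ {suc m} (λ k → pellRows e m a (toℕ k) * pellFrom m (toℕ k))
    ≡⟨ Σ-toℕ (suc m) (λ k → pellRows e m a k * pellFrom m k) ⟩
  dot (suc m) (pellRows e m a) (pellFrom m)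
    ≡⟨ dot-pellRows e (pellFrom m) (pellFrom-PellLike m) a≤m ⟩
  pellFrom m ((m ∸ a) ℕ.* suc e ℕ.+ a ℕ.* suc (suc e))
    ≡⟨ cong (pellFrom m) index ⟩
  pellFrom m (m ℕ.+ (m ℕ.* e ℕ.+ a))
    ≡⟨ pellFrom-shift m (m ℕ.* e ℕ.+ a) ⟩
  P (m ℕ.* e ℕ.+ a) ∎
  where
  open ≡-Reasoning
  a = toℕ j
  a≤m = Fin.toℕ≤pred[n] j
  regroup : ∀ a d e → d ℕ.* suc e ℕ.+ a ℕ.* suc (suc e) ≡ (a ℕ.+ d) ℕ.+ ((a ℕ.+ d) ℕ.* e ℕ.+ a)
  regroup = ℕ-Solver.solve-∀
  index : (m ∸ a) ℕ.* suc e ℕ.+ a ℕ.* suc (suc e) ≡ m ℕ.+ (m ℕ.* e ℕ.+ a)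
  index = trans (regroup a (m ∸ a) e) (cong (λ n → n ℕ.+ (n ℕ.* e ℕ.+ a)) (ℕ.m+[n∸m]≡n a≤m))

theorem3p1 : (m : ℕ) →
    ((e : ℕ) → (j : Fin (suc m)) →
        ((T (suc m) ^^ suc e) · v (suc m)) j ≡ P (m Data.Nat.* e Data.Nat.+ toℕ j))
    × ((e : ℕ) → (i j : Fin m) →
        P e * (T (suc m) ^^ suc e) (suc i) (suc j)
          + P (suc e) * (T (suc m) ^^ suc e) (suc i) (inject₁ j)
        ≡ P (suc e) * (T (suc m) ^^ suc e) (inject₁ i) (suc j)
          + P (suc (suc e)) * (T (suc m) ^^ suc e) (inject₁ i) (inject₁ j))
    × (((j : Fin m) → T (suc m) zero (inject₁ j) ≡ + 0)
      × ((i : Fin (suc m)) → T (suc m) i (fromℕ m) ≡ + (2 Data.Nat.^ toℕ i))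
      × ((i j : Fin m) → T (suc m) (suc i) (inject₁ j)
          ≡ + 2 * T (suc m) (inject₁ i) (inject₁ j) + T (suc m) (inject₁ i) (suc j)))
    × ((B : Mat (suc m)) →
        ((j : Fin m) → B zero (inject₁ j) ≡ + 0) →
        ((i : Fin (suc m)) → B i (fromℕ m) ≡ + (2 Data.Nat.^ toℕ i)) →
        ((i j : Fin m) → B (suc i) (inject₁ j)
          ≡ + 2 * B (inject₁ i) (inject₁ j) + B (inject₁ i) (suc j)) →
        (i j : Fin (suc m)) → B i j ≡ T (suc m) i j)
theorem3p1 m =
    T^·v m
  , T^-adjacent m
  , T-conditions m
  , λ B top last rec → TConditions-unique (top , last , rec) (T-conditions m)
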